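{- If $G$ is an OAT graph, then $\chi(G)=\omega(G)$.
   Context: All graphs are finite and simple; $\chi$ is the chromatic number and $\omega$ the clique number. For non-adjacent vertices $u,v$, $u$ is comparable to $v$ if $N(u)\subseteq N(v)$. A graph is an OAT graph if it can be constructed from single-vertex graphs by a finite sequence of the following operations, where $G_1=(V_1,E_1)$, $G_2=(V_2,E_2)$ are vertex-disjoint OAT graphs: (1) disjoint union $(V_1\cup V_2,E_1\cup E_2)$; (2) join $(V_1\cup V_2, E_1\cup E_2\cup\{xy: x\in V_1,y\in V_2\})$; (3) adding a comparable vertex: for $v\in V_1$ and a new vertex $u\notin V_1$, form $(V_1\cup\{u\}, E_1\cup\{ux: x\in X\})$ for some $X\subseteq N(v)$; (4) attaching a clique: for a complete graph $Q=(V_Q,E_Q)$ disjoint from $G_1$ and $v\in V_1$, form $(V_1\cup V_Q, E_1\cup E_Q\cup\{qv: q\in V_Q\})$. -}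

module Defs where

open import Data.Nat using (ℕ; zero; suc; _+_; _≤_)
open import Data.Fin using (Fin; zero; suc; splitAt; _≟_)
open import Data.Bool using (Bool; true; false; not)
open import Data.Sum using (_⊎_; inj₁; inj₂)
open import Data.Product using (Σ; _×_; _,_)
open import Relation.Nullary using (¬_)
open import Relation.Nullary.Decidable using (⌊_⌋)
open import Relation.Binary.PropositionalEquality using (_≡_)
open import Function.Bundles using (_↔_; Inverse)
open import Function.Definitions using (Injective)

-- A finite simple graph on vertex set Fin n is given by a Boolean adjacency
-- function.  (Symmetry and irreflexivity are preserved by all OAT operations,
-- so every OAT graph is automatically simple; see IsSimple below.)
Adj : ℕ → Set
Adj n = Fin n → Fin n → Bool

IsSimple : ∀ {n} → Adj n → Set
IsSimple {n} A = (∀ x y → A x y ≡ A y x) × (∀ x → A x x ≡ false)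

single : Adj 1
single _ _ = false

disjUnion : ∀ {m n} → Adj m → Adj n → Adj (m + n)
disjUnion {m} A B x y with splitAt m x | splitAt m y
... | inj₁ a | inj₁ b = A a b
... | inj₂ a | inj₂ b = B a b
... | inj₁ _ | inj₂ _ = false
... | inj₂ _ | inj₁ _ = false

join : ∀ {m n} → Adj m → Adj n → Adj (m + n)
join {m} A B x y with splitAt m x | splitAt m y
... | inj₁ a | inj₁ b = A a b
... | inj₂ a | inj₂ b = B a b
... | inj₁ _ | inj₂ _ = true
... | inj₂ _ | inj₁ _ = true

-- (3) adding a vertex (the new vertex is zero, old vertex x becomes suc x)
-- whose neighbourhood is X; the hypothesis X ⊆ N(v) is imposed in OAT below.
addVertex : ∀ {n} → Adj n → (Fin n → Bool) → Adj (suc n)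
addVertex A X zero    zero    = false
addVertex A X zero    (suc y) = X y
addVertex A X (suc x) zero    = X x
addVertex A X (suc x) (suc y) = A x y

attachClique : ∀ {n} → Adj n → Fin n → (k : ℕ) → Adj (n + k)
attachClique {n} A v k x y with splitAt n x | splitAt n y
... | inj₁ a | inj₁ b = A a b
... | inj₂ i | inj₂ j = not ⌊ i ≟ j ⌋
... | inj₁ a | inj₂ _ = ⌊ a ≟ v ⌋
... | inj₂ _ | inj₁ b = ⌊ b ≟ v ⌋

_≅_ : ∀ {m n} → Adj m → Adj n → Set
_≅_ {m} {n} A B = Σ (Fin m ↔ Fin n) λ σ →
  ∀ x y → B (Inverse.to σ x) (Inverse.to σ y) ≡ A x y

-- OAT graphs (closed under relabelling of vertices, i.e. isomorphism)
data OAT : ∀ {n} → Adj n → Set where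
  oat-single : OAT single
  oat-union  : ∀ {m n} {A : Adj m} {B : Adj n} → OAT A → OAT B → OAT (disjUnion A B)
  oat-join   : ∀ {m n} {A : Adj m} {B : Adj n} → OAT A → OAT B → OAT (join A B)
  oat-comp   : ∀ {n} {A : Adj n} (v : Fin n) (X : Fin n → Bool) →
               (∀ x → X x ≡ true → A v x ≡ true) → OAT A → OAT (addVertex A X)
  oat-clique : ∀ {n} {A : Adj n} (v : Fin n) (k : ℕ) → OAT A → OAT (attachClique A v k)
  oat-iso    : ∀ {m n} {A : Adj m} {B : Adj n} → A ≅ B → OAT A → OAT B

Colorable : ∀ {n} → Adj n → ℕ → Set
Colorable {n} A k = Σ (Fin n → Fin k) λ c → ∀ x y → A x y ≡ true → ¬ (c x ≡ c y)

HasClique : ∀ {n} → Adj n → ℕ → Set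
HasClique {n} A k = Σ (Fin k → Fin n) λ f →
  Injective _≡_ _≡_ f × (∀ i j → ¬ (i ≡ j) → A (f i) (f j) ≡ true)

IsChromaticNumber : ∀ {n} → Adj n → ℕ → Set
IsChromaticNumber A k = Colorable A k × (∀ j → Colorable A j → k ≤ j)

IsCliqueNumber : ∀ {n} → Adj n → ℕ → Set
IsCliqueNumber A k = HasClique A k × (∀ j → HasClique A j → j ≤ k)

module Submission where

-- Call a graph *tight* if, for some k, it has both a proper k-colouring and
-- a k-clique.  Since a clique needs pairwise distinct colours (pigeonhole),
-- a tight graph has χ = ω = k; so it suffices to show that every OAT graph
-- is tight, by induction on the OAT construction.

open import Defs
open import Data.Nat using (ℕ; zero; suc; _+_; _≤_; s≤s)
open import Data.Nat.Properties using (≤-total; ≤-refl)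
open import Data.Fin using (Fin; zero; suc; splitAt; _≟_; _↑ˡ_; _↑ʳ_; inject≤; punchIn)
  renaming (join to joinFin)
open import Data.Fin.Properties
  using (injective⇒≤; splitAt-↑ˡ; splitAt-↑ʳ; splitAt-join; join-splitAt;
         ↑ˡ-injective; ↑ʳ-injective; inject≤-injective; punchIn-injective; punchInᵢ≢i; suc-injective)
open import Data.Sum using (_⊎_; inj₁; inj₂)
open import Data.Sum.Properties using (inj₁-injective; inj₂-injective)
open import Data.Product using (Σ; _×_; _,_)
open import Data.Bool using (Bool; true; false; not)
open import Data.Empty using (⊥-elim)
open import Relation.Nullary using (¬_; yes; no)
open import Relation.Nullary.Decidable using (⌊_⌋; isYes≗does; dec-true; dec-false)
open import Relation.Binary.PropositionalEquality using (_≡_; _≢_; refl; sym; trans; cong; cong₂)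
open import Function.Bundles using (Inverse)
open import Function.Definitions using (Injective)

Graph : Set → Set
Graph W = W → W → Bool

-- Proper colourings and cliques indexed by a type I; for W = Fin n and
-- I = Fin k these are definitionally Colorable and HasClique from Defs.
Colouring : ∀ {W} → Graph W → ℕ → Set
Colouring {W} H k = Σ (W → Fin k) λ c → ∀ x y → H x y ≡ true → ¬ (c x ≡ c y)

Clique : ∀ {W} → Graph W → Set → Set
Clique {W} H I = Σ (I → W) λ f →
  Injective _≡_ _≡_ f × (∀ i j → ¬ (i ≡ j) → H (f i) (f j) ≡ true)

Tight : ∀ {W} → Graph W → Set
Tight H = Σ ℕ λ k → Colouring H k × Clique H (Fin k)

Homomorphism : ∀ {V W} → Graph V → Graph W → (V → W) → Set
Homomorphism G H e = ∀ x y → G x y ≡ true → H (e x) (e y) ≡ true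

-- Weak duality ω ≤ χ: the colours along a clique are pairwise distinct.
clique≤colours : ∀ {W} (H : Graph W) {k j} → Clique H (Fin k) → Colouring H j → k ≤ j
clique≤colours H {k} (f , _ , adjacent) (c , proper) = injective⇒≤ colours-distinct
  where
  colours-distinct : Injective _≡_ _≡_ (λ (i : Fin k) → c (f i))
  colours-distinct {i} {j} same with i ≟ j
  ... | yes i≡j = i≡j
  ... | no i≢j = ⊥-elim (proper (f i) (f j) (adjacent i j i≢j) same)

tight⇒χ≡ω : ∀ {n} (G : Adj n) → Tight G → Σ ℕ (λ k → IsChromaticNumber G k × IsCliqueNumber G k)
tight⇒χ≡ω G (k , colouring , clique) =
  k , (colouring , λ j colouringⱼ → clique≤colours G clique colouringⱼ)
    , (clique , λ j cliqueⱼ → clique≤colours G cliqueⱼ colouring)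

colouring-pullback : ∀ {V W} {G : Graph V} {H : Graph W} {e : V → W} {k} →
  Homomorphism G H e → Colouring H k → Colouring G k
colouring-pullback {e = e} hom (c , proper) =
  (λ x → c (e x)) , λ x y edge → proper (e x) (e y) (hom x y edge)

colouring-widen : ∀ {W} {H : Graph W} {k k'} → k ≤ k' → Colouring H k → Colouring H k'
colouring-widen k≤k' (c , proper) =
  (λ x → inject≤ (c x) k≤k') ,
  λ x y edge same → proper x y edge (inject≤-injective k≤k' k≤k' _ _ same)

clique-image : ∀ {V W I} (G : Graph V) (H : Graph W) (e : V → W) →
  Injective _≡_ _≡_ e → Homomorphism G H e → Clique G I → Clique H I
clique-image G H e e-injective hom (f , f-injective , adjacent) =
  (λ i → e (f i)) , (λ same → f-injective (e-injective same)) ,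
  λ i j i≢j → hom (f i) (f j) (adjacent i j i≢j)

clique-reindex : ∀ {W I J} {H : Graph W} (r : J → I) →
  Injective _≡_ _≡_ r → Clique H I → Clique H J
clique-reindex r r-injective (f , f-injective , adjacent) =
  (λ j → f (r j)) , (λ same → r-injective (f-injective same)) ,
  λ i j i≢j → adjacent (r i) (r j) (λ same → i≢j (r-injective same))

-- Tightness transfers along a relabelling e that has a section d: the
-- colouring pulls back along e, and the clique is carried over by d.
tight-relabel : ∀ {V W} {G : Graph V} {H : Graph W} (e : V → W) (d : W → V) →
  (∀ x y → G x y ≡ H (e x) (e y)) → (∀ w → e (d w) ≡ w) → Tight H → Tight G
tight-relabel {G = G} {H} e d G≡H section (k , colouring , clique) =
  k , colouring-pullback e-hom colouring , clique-image H G d d-injective d-hom clique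
  where
  e-hom : Homomorphism G H e
  e-hom x y edge = trans (sym (G≡H x y)) edge
  d-injective : Injective _≡_ _≡_ d
  d-injective {u} {w} same = trans (sym (section u)) (trans (cong e same) (section w))
  d-hom : Homomorphism H G d
  d-hom u w edge = trans (G≡H (d u) (d w)) (trans (cong₂ H (section u) (section w)) edge)

tight-splitAt : ∀ {m n} (G : Adj (m + n)) (H : Graph (Fin m ⊎ Fin n)) →
  (∀ x y → G x y ≡ H (splitAt m x) (splitAt m y)) → Tight H → Tight G
tight-splitAt {m} {n} G H G≡H = tight-relabel (splitAt m) (joinFin m n) G≡H (splitAt-join m n)

splitAt-injective : ∀ m {n} → Injective _≡_ _≡_ (splitAt m {n})
splitAt-injective m {n} {i} {j} same =
  trans (sym (join-splitAt m n i)) (trans (cong (joinFin m n) same) (join-splitAt m n j))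

_⊕_ : ∀ {V W} → Graph V → Graph W → Graph (V ⊎ W)
(G ⊕ H) (inj₁ x) (inj₁ y) = G x y
(G ⊕ H) (inj₂ x) (inj₂ y) = H x y
(G ⊕ H) (inj₁ _) (inj₂ _) = false
(G ⊕ H) (inj₂ _) (inj₁ _) = false

_⊗_ : ∀ {V W} → Graph V → Graph W → Graph (V ⊎ W)
(G ⊗ H) (inj₁ x) (inj₁ y) = G x y
(G ⊗ H) (inj₂ x) (inj₂ y) = H x y
(G ⊗ H) (inj₁ _) (inj₂ _) = true
(G ⊗ H) (inj₂ _) (inj₁ _) = true

glue : ∀ {n} → Adj n → Fin n → (k : ℕ) → Graph (Fin n ⊎ Fin k)
glue G v k (inj₁ x) (inj₁ y) = G x y
glue G v k (inj₂ i) (inj₂ j) = not ⌊ i ≟ j ⌋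
glue G v k (inj₁ x) (inj₂ _) = ⌊ x ≟ v ⌋
glue G v k (inj₂ _) (inj₁ y) = ⌊ y ≟ v ⌋

disjUnion-via-splitAt : ∀ {m n} (A : Adj m) (B : Adj n) x y →
  disjUnion A B x y ≡ (A ⊕ B) (splitAt m x) (splitAt m y)
disjUnion-via-splitAt {m} A B x y with splitAt m x | splitAt m y
... | inj₁ _ | inj₁ _ = refl
... | inj₂ _ | inj₂ _ = refl
... | inj₁ _ | inj₂ _ = refl
... | inj₂ _ | inj₁ _ = refl

join-via-splitAt : ∀ {m n} (A : Adj m) (B : Adj n) x y →
  join A B x y ≡ (A ⊗ B) (splitAt m x) (splitAt m y)
join-via-splitAt {m} A B x y with splitAt m x | splitAt m y
... | inj₁ _ | inj₁ _ = refl
... | inj₂ _ | inj₂ _ = refl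
... | inj₁ _ | inj₂ _ = refl
... | inj₂ _ | inj₁ _ = refl

attachClique-via-splitAt : ∀ {n} (A : Adj n) v k x y →
  attachClique A v k x y ≡ glue A v k (splitAt n x) (splitAt n y)
attachClique-via-splitAt {n} A v k x y with splitAt n x | splitAt n y
... | inj₁ _ | inj₁ _ = refl
... | inj₂ _ | inj₂ _ = refl
... | inj₁ _ | inj₂ _ = refl
... | inj₂ _ | inj₁ _ = refl

-- Disjoint union.  Both sides are coloured from the larger palette and the
-- larger of the two cliques survives.
colouring-⊕ : ∀ {V W} {G : Graph V} {H : Graph W} {k} →
  Colouring G k → Colouring H k → Colouring (G ⊕ H) k
colouring-⊕ {G = G} {H} {k} (c₁ , proper₁) (c₂ , proper₂) = c , proper
  where
  c : _ ⊎ _ → Fin k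
  c (inj₁ x) = c₁ x
  c (inj₂ y) = c₂ y
  proper : ∀ s t → (G ⊕ H) s t ≡ true → c s ≢ c t
  proper (inj₁ x) (inj₁ y) edge = proper₁ x y edge
  proper (inj₂ x) (inj₂ y) edge = proper₂ x y edge

tight-⊕ : ∀ {V W} {G : Graph V} {H : Graph W} → Tight G → Tight H → Tight (G ⊕ H)
tight-⊕ {G = G} {H} (k₁ , colouring₁ , clique₁) (k₂ , colouring₂ , clique₂) with ≤-total k₂ k₁
... | inj₁ k₂≤k₁ = k₁ , colouring-⊕ colouring₁ (colouring-widen k₂≤k₁ colouring₂) ,
                   clique-image G (G ⊕ H) inj₁ inj₁-injective (λ x y edge → edge) clique₁
... | inj₂ k₁≤k₂ = k₂ , colouring-⊕ (colouring-widen k₁≤k₂ colouring₁) colouring₂ ,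
                   clique-image H (G ⊕ H) inj₂ inj₂-injective (λ x y edge → edge) clique₂

-- Join.  Disjoint palettes give a (k₁ + k₂)-colouring, and the union of
-- the two cliques is a clique since every cross pair is adjacent.
colouring-⊗ : ∀ {V W} {G : Graph V} {H : Graph W} {k₁ k₂} →
  Colouring G k₁ → Colouring H k₂ → Colouring (G ⊗ H) (k₁ + k₂)
colouring-⊗ {G = G} {H} {k₁} {k₂} (c₁ , proper₁) (c₂ , proper₂) = c , proper
  where
  c : _ → Fin (k₁ + k₂)
  c (inj₁ x) = c₁ x ↑ˡ k₂
  c (inj₂ y) = k₁ ↑ʳ c₂ y
  palettes-disjoint : ∀ (i : Fin k₁) (j : Fin k₂) → i ↑ˡ k₂ ≢ k₁ ↑ʳ j
  palettes-disjoint i j same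
    with trans (sym (splitAt-↑ˡ k₁ i k₂)) (trans (cong (splitAt k₁) same) (splitAt-↑ʳ k₁ k₂ j))
  ... | ()
  proper : ∀ s t → (G ⊗ H) s t ≡ true → c s ≢ c t
  proper (inj₁ x) (inj₁ y) edge same = proper₁ x y edge (↑ˡ-injective k₂ _ _ same)
  proper (inj₂ x) (inj₂ y) edge same = proper₂ x y edge (↑ʳ-injective k₁ _ _ same)
  proper (inj₁ x) (inj₂ y) _ same = palettes-disjoint _ _ same
  proper (inj₂ x) (inj₁ y) _ same = palettes-disjoint _ _ (sym same)

clique-⊗ : ∀ {V W I J} {G : Graph V} {H : Graph W} →
  Clique G I → Clique H J → Clique (G ⊗ H) (I ⊎ J)
clique-⊗ {G = G} {H} (f₁ , injective₁ , adjacent₁) (f₂ , injective₂ , adjacent₂) = f , injective , adjacent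
  where
  f : _ ⊎ _ → _ ⊎ _
  f (inj₁ i) = inj₁ (f₁ i)
  f (inj₂ j) = inj₂ (f₂ j)
  injective : Injective _≡_ _≡_ f
  injective {inj₁ _} {inj₁ _} same = cong inj₁ (injective₁ (inj₁-injective same))
  injective {inj₂ _} {inj₂ _} same = cong inj₂ (injective₂ (inj₂-injective same))
  injective {inj₁ _} {inj₂ _} ()
  injective {inj₂ _} {inj₁ _} ()
  adjacent : ∀ s t → s ≢ t → (G ⊗ H) (f s) (f t) ≡ true
  adjacent (inj₁ i) (inj₁ j) i≢j = adjacent₁ i j (λ same → i≢j (cong inj₁ same))
  adjacent (inj₂ i) (inj₂ j) i≢j = adjacent₂ i j (λ same → i≢j (cong inj₂ same))
  adjacent (inj₁ _) (inj₂ _) _ = refl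
  adjacent (inj₂ _) (inj₁ _) _ = refl

tight-⊗ : ∀ {V W} {G : Graph V} {H : Graph W} → Tight G → Tight H → Tight (G ⊗ H)
tight-⊗ {G = G} {H} (k₁ , colouring₁ , clique₁) (k₂ , colouring₂ , clique₂) =
  k₁ + k₂ , colouring-⊗ colouring₁ colouring₂ ,
  clique-reindex {H = G ⊗ H} (splitAt k₁) (splitAt-injective k₁) (clique-⊗ clique₁ clique₂)

-- Comparable vertex.  The new vertex reuses the colour of v: its
-- neighbours are neighbours of v, so they avoid that colour.  G sits inside
-- unchanged, so its clique survives.
fold-onto : ∀ {n} → Fin n → Fin (suc n) → Fin n
fold-onto v zero = v
fold-onto v (suc x) = x

tight-addVertex : ∀ {n} {A : Adj n} (v : Fin n) (X : Fin n → Bool) →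
  (∀ x → X x ≡ true → A v x ≡ true) → Tight A → Tight (addVertex A X)
tight-addVertex {A = A} v X X⊆N[v] (k , (c , proper) , clique) =
  k , ((λ x → c (fold-onto v x)) , proper') , clique-image A (addVertex A X) suc suc-injective (λ x y edge → edge) clique
  where
  proper' : ∀ x y → addVertex A X x y ≡ true → c (fold-onto v x) ≢ c (fold-onto v y)
  proper' zero (suc y) edge = proper v y (X⊆N[v] y edge)
  proper' (suc x) zero edge same = proper v x (X⊆N[v] x edge) (sym same)
  proper' (suc x) (suc y) edge = proper x y edge

-- Attaching a clique at v.  Given K + 1 ≥ k + 1 colours, the new vertices
-- take k distinct colours, all different from that of v (punchIn skips it).
colouring-glue : ∀ {n} {A : Adj n} (v : Fin n) {k K} → k ≤ K →
  Colouring A (suc K) → Colouring (glue A v k) (suc K)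
colouring-glue {n} {A} v {k} {K} k≤K (c , proper) = c' , proper'
  where
  c' : Fin n ⊎ Fin k → Fin (suc K)
  c' (inj₁ x) = c x
  c' (inj₂ i) = punchIn (c v) (inject≤ i k≤K)
  proper' : ∀ s t → glue A v k s t ≡ true → c' s ≢ c' t
  proper' (inj₁ x) (inj₁ y) edge = proper x y edge
  proper' (inj₂ i) (inj₂ j) edge same with i ≟ j
  proper' (inj₂ i) (inj₂ j) () same | yes _
  ... | no i≢j = i≢j (inject≤-injective k≤K k≤K _ _ (punchIn-injective (c v) _ _ same))
  proper' (inj₁ x) (inj₂ j) edge same with x ≟ v
  proper' (inj₁ x) (inj₂ j) () same | no _
  ... | yes refl = punchInᵢ≢i (c x) _ (sym same)
  proper' (inj₂ i) (inj₁ y) edge same with y ≟ v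
  proper' (inj₂ i) (inj₁ y) () same | no _
  ... | yes refl = punchInᵢ≢i (c y) _ same

≟-reflexive : ∀ {n} (v : Fin n) → ⌊ v ≟ v ⌋ ≡ true
≟-reflexive v = trans (isYes≗does (v ≟ v)) (dec-true (v ≟ v) refl)

≟-distinct : ∀ {n} (i j : Fin n) → i ≢ j → not ⌊ i ≟ j ⌋ ≡ true
≟-distinct i j i≢j = cong not (trans (isYes≗does (i ≟ j)) (dec-false (i ≟ j) i≢j))

clique-glue : ∀ {n} (A : Adj n) (v : Fin n) (k : ℕ) → Clique (glue A v k) (Fin (suc k))
clique-glue {n} A v k = f , injective , adjacent
  where
  f : Fin (suc k) → Fin n ⊎ Fin k
  f zero = inj₁ v
  f (suc i) = inj₂ i
  injective : Injective _≡_ _≡_ f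
  injective {zero} {zero} _ = refl
  injective {suc _} {suc _} same = cong suc (inj₂-injective same)
  injective {zero} {suc _} ()
  injective {suc _} {zero} ()
  adjacent : ∀ i j → i ≢ j → glue A v k (f i) (f j) ≡ true
  adjacent zero zero i≢j = ⊥-elim (i≢j refl)
  adjacent zero (suc _) _ = ≟-reflexive v
  adjacent (suc _) zero _ = ≟-reflexive v
  adjacent (suc i) (suc j) i≢j = ≟-distinct i j (λ same → i≢j (cong suc same))

-- If A is tight with k₁ = K + 1 ≥ k + 1, the K + 1 colours and the clique
-- of A suffice; otherwise the glued (k + 1)-clique is the largest and
-- k + 1 colours are enough.
tight-glue : ∀ {n} {A : Adj n} (v : Fin n) (k : ℕ) → Tight A → Tight (glue A v k)
tight-glue {A = A} v k (k₁ , colouring , clique) with ≤-total (suc k) k₁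
... | inj₁ (s≤s k≤K) =
  k₁ , colouring-glue v k≤K colouring , clique-image A (glue A v k) inj₁ inj₁-injective (λ x y edge → edge) clique
... | inj₂ k₁≤1+k =
  suc k , colouring-glue v ≤-refl (colouring-widen k₁≤1+k colouring) , clique-glue A v k

tight-single : Tight single
tight-single =
  1 , ((λ _ → zero) , λ _ _ ()) , ((λ i → i) , (λ same → same) , λ { zero zero i≢j → ⊥-elim (i≢j refl) })

oat-tight : ∀ {n} {G : Adj n} → OAT G → Tight G
oat-tight oat-single = tight-single
oat-tight (oat-union {A = A} {B} a b) =
  tight-splitAt (disjUnion A B) (A ⊕ B) (disjUnion-via-splitAt A B) (tight-⊕ (oat-tight a) (oat-tight b))
oat-tight (oat-join {A = A} {B} a b) =
  tight-splitAt (join A B) (A ⊗ B) (join-via-splitAt A B) (tight-⊗ (oat-tight a) (oat-tight b))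
oat-tight (oat-comp v X X⊆N[v] a) = tight-addVertex v X X⊆N[v] (oat-tight a)
oat-tight (oat-clique {A = A} v k a) =
  tight-splitAt (attachClique A v k) (glue A v k) (attachClique-via-splitAt A v k) (tight-glue v k (oat-tight a))
-- An isomorphism σ : A ≅ B relabels B along σ⁻¹, which has section σ.
oat-tight (oat-iso {A = A} {B} (σ , A≅B) a) =
  tight-relabel from to B≡A strictlyInverseʳ (oat-tight a)
  where
  open Inverse σ
  B≡A : ∀ x y → B x y ≡ A (from x) (from y)
  B≡A x y = trans (sym (cong₂ B (strictlyInverseˡ x) (strictlyInverseˡ y))) (A≅B (from x) (from y))

mainTheorem2 : ∀ {n} (G : Adj n) → OAT G →
    Σ ℕ (λ k → IsChromaticNumber G k × IsCliqueNumber G k)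
mainTheorem2 G oat = tight⇒χ≡ω G (oat-tight oat)
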